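{- $\mathscr{T}(4,11)=\mathscr{D}(4,11)-1$.
   Context: A numerical monoid is an additive submonoid $\Gamma\subseteq\mathbb{N}$ (containing $0$) with $\mathbb{N}\setminus\Gamma$ finite. It has a unique minimal set of generators $g_0<g_1<\cdots<g_e$; its embedding dimension is $\mathrm{edim}(\Gamma)=e+1$ and its multiplicity is $\mathrm{mult}(\Gamma)=g_0$. An integer $p\in\mathbb{N}\setminus\Gamma$ is a pseudo-Frobenius number of $\Gamma$ if $p+g\in\Gamma$ for all $g\in\Gamma\setminus\{0\}$; the type $\mathrm{type}(\Gamma)$ is the number of pseudo-Frobenius numbers. Define $\mathscr{T}(e,m)=\max\{\mathrm{type}(\Gamma): \mathrm{edim}(\Gamma)=e+1,\ \mathrm{mult}(\Gamma)=m\}$. For positive integers $n,d$ write the Macaulay expansion $n=\binom{n_d}{d}+\cdots+\binom{n_j}{j}$ with uniquely determined integers $n_d>n_{d-1}>\cdots>n_j\geq j\geq 1$, and set $n_{\langle d\rangle}=\binom{n_d-1}{d}+\cdots+\binom{n_j-1}{j}$; set $0_{\langle d\rangle}=0$. For integers $1<e<m$, let $r$ be the unique integer with $\binom{e+r-1}{r-1}\leq m<\binom{e+r}{r}$, let $s=m-\binom{e+r-1}{r-1}$, and define $\mathscr{D}(e,m)=\binom{e+r-2}{r-1}+s_{\langle r\rangle}$. -}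

module Defs where

open import Level using (0ℓ)
open import Data.Bool using (Bool; true; false; if_then_else_)
open import Data.Nat using (ℕ; zero; suc; _+_; _∸_; _≤_; _<_; _≤ᵇ_; _<ᵇ_)
open import Data.Nat.Combinatorics using (_C_)
open import Data.List using (List; length)
open import Data.List.Membership.Propositional using (_∈_)
open import Data.List.Relation.Unary.Unique.Propositional using (Unique)
open import Data.Product using (Σ; ∃; _×_; _,_)
open import Relation.Nullary using (¬_)
open import Relation.Unary using (Pred; Decidable)
open import Relation.Binary.PropositionalEquality using (_≡_; _≢_)
open import Function.Bundles using (_⇔_)

-- Numerical monoids: submonoids of (ℕ,+) with finite complement.
-- (Membership is assumed decidable; every subset of ℕ with finite
-- complement is classically decidable, so this is a harmless
-- constructive convention.)

record NumericalMonoid : Set₁ where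
  field
    _∈Γ      : Pred ℕ 0ℓ
    dec      : Decidable _∈Γ
    zero∈    : 0 ∈Γ
    closed   : ∀ {a b} → a ∈Γ → b ∈Γ → (a + b) ∈Γ
    cofinite : ∃ λ F → ∀ n → F < n → n ∈Γ

open NumericalMonoid public

HasCard : Pred ℕ 0ℓ → ℕ → Set
HasCard P k = Σ (List ℕ) λ L → Unique L × (∀ x → (x ∈ L) ⇔ P x) × (length L ≡ k)

-- Minimal generators of Γ: elements of Γ∖{0} not a sum of two elements
-- of Γ∖{0}; this is the unique minimal generating set of Γ.
MinGen : NumericalMonoid → Pred ℕ 0ℓ
MinGen Γ x = (_∈Γ Γ x) × (x ≢ 0) ×
  ¬ (∃ λ a → ∃ λ b → _∈Γ Γ a × _∈Γ Γ b × a ≢ 0 × b ≢ 0 × a + b ≡ x)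

Edim : NumericalMonoid → ℕ → Set
Edim Γ k = HasCard (MinGen Γ) k

Mult : NumericalMonoid → ℕ → Set
Mult Γ m = _∈Γ Γ m × m ≢ 0 × (∀ x → _∈Γ Γ x → x ≢ 0 → m ≤ x)

PF : NumericalMonoid → Pred ℕ 0ℓ
PF Γ p = ¬ (_∈Γ Γ p) × (∀ g → _∈Γ Γ g → g ≢ 0 → _∈Γ Γ (p + g))

Type : NumericalMonoid → ℕ → Set
Type Γ t = HasCard (PF Γ) t

IsT : ℕ → ℕ → ℕ → Set₁
IsT e m t =
  (∃ λ Γ → Edim Γ (suc e) × Mult Γ m × Type Γ t) ×
  (∀ Γ t' → Edim Γ (suc e) → Mult Γ m → Type Γ t' → t' ≤ t)

-- greatest k ≤ b with p k ≡ true (0 if none)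
greatest : (ℕ → Bool) → ℕ → ℕ
greatest p zero    = zero
greatest p (suc b) = if p (suc b) then suc b else greatest p b

-- n_d = the largest a with C(a,d) ≤ n (a ≤ n + d always suffices)
topIndex : ℕ → ℕ → ℕ
topIndex n d = greatest (λ a → (a C d) ≤ᵇ n) (n + d)

-- n_⟨d⟩ via the greedy construction of the Macaulay expansion:
-- n = C(n_d,d) + (n - C(n_d,d)), the remainder expanded w.r.t. d-1.
lowerMac : ℕ → ℕ → ℕ
lowerMac zero    n       = 0
lowerMac (suc d) zero    = 0
lowerMac (suc d) (suc n) =
  let a = topIndex (suc n) (suc d) in
  ((a ∸ 1) C suc d) + lowerMac d (suc n ∸ (a C suc d))

-- r = unique r with C(e+r-1,r-1) ≤ m < C(e+r,r): the least r ≥ 1 with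
-- m < C(e+r,r) (these binomials are strictly increasing in r and
-- C(e,0) = 1 ≤ m); searched among 1..m+1.
findR : ℕ → ℕ → ℕ → ℕ → ℕ
findR e m r zero       = r
findR e m r (suc fuel) = if m <ᵇ ((e + r) C r) then r else findR e m (suc r) fuel

rOf : ℕ → ℕ → ℕ
rOf e m = findR e m 1 (suc m)

𝒟 : ℕ → ℕ → ℕ
𝒟 e m =
  let r = rOf e m
      s = m ∸ ((e + r ∸ 1) C (r ∸ 1))
  in ((e + r ∸ 2) C (r ∸ 1)) + lowerMac r s

-- Let Γ have multiplicity m = 11, five minimal generators and type t. Pseudo-Frobenius numbers
-- lie in distinct nonzero classes mod m, so the set N of classes containing none of them has
-- 0 ∈ N and |N| ≤ m − t, while the set H of classes of the generators other than m has |H| ≤ 4.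
-- Let r be a nonzero class and w its Apéry element (the least element of Γ in r). Either w is a
-- generator, and r ∈ H, or w = g + s with g a generator and s ∈ Γ∖{0}; then g ≠ m, and neither g
-- nor s is congruent to a pseudo-Frobenius number p, for if g = p + (k+1)m then
-- w − m = (p + s) + km ∈ Γ. Hence r ∈ H, or r − a ∈ N for some a ∈ H ∩ N. An exhaustive search
-- shows that modulo 11 this is impossible with |N| ≤ 4 and |H| ≤ 4, so t ≤ 6. The value 6 is
-- attained by ⟨11, 12, 13, 14, 18⟩, and 𝒟(4,11) = 7.

module Submission where

open import Defs
open import Level using (0ℓ)
open import Data.Bool using (Bool; false; _∧_; _∨_; T)
open import Data.Bool.Properties using (T-≡; T-∧; T-∨)
open import Data.Nat
  using (ℕ; zero; suc; _+_; _*_; _∸_; _≤_; _<_; z≤n; s≤s; NonZero; ≢-nonZero; _≟_; _≤?_; _≡ᵇ_)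
open import Data.Nat.Properties
open import Data.Nat.DivMod
  using (_%_; _/_; _mod_; m≡m%n+[m/n]*n; /-monoˡ-≤; %-distribˡ-+; m%n%n≡m%n; m%n≤n;
         [m+kn]%n≡m%n; m<n⇒m%n≡m; m*n%n≡0; n%n≡0)
open import Data.Nat.Induction using (<-wellFounded)
open import Data.Nat.Tactic.RingSolver using (solve-∀)
open import Induction.WellFounded using (Acc; acc)
open import Data.Fin using (Fin; toℕ) renaming (zero to 0F)
open import Data.Fin.Properties using (toℕ-fromℕ<; toℕ-injective; toℕ<n)
open import Data.Fin.Subset
  using (Subset; inside; outside; ⊥; ⁅_⁆; _∪_; ∁; _-_; ∣_∣) renaming (_∈_ to _∈ₛ_)
open import Data.Fin.Subset.Properties
  using (x∈⁅x⁆; x∈⁅y⁆⇒x≡y; x∈p∪q⁺; x∈p∪q⁻; ∉⊥; ∪-identityˡ; ∣p∣≤∣x∷p∣; ∣⊥∣≡0;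
         ∣∁p∣≡n∸∣p∣; x∈p∧x≢y⇒x∈p-y; x∈p⇒∣p-x∣<∣p∣; x∉p⇒x∈∁p)
open import Data.Vec using ([]; _∷_; lookup; here)
open import Data.Vec.Properties using ([]=⇒lookup)
open import Data.List using (List; []; _∷_; _++_; length; map; filter; upTo; allFin)
open import Data.Bool.ListAction using (all; any)
open import Data.List.Properties using (length-map; filter-notAll)
open import Data.List.Membership.Propositional using (_∈_; lose)
open import Data.List.Membership.Propositional.Properties
  using (∈-filter⁺; ∈-filter⁻; ∈-upTo⁺; ∈-map⁺; ∈-++⁺ˡ; ∈-++⁺ʳ; ∈-allFin)
open import Data.List.Relation.Unary.Any as Any using (here; there)
open import Data.List.Relation.Unary.Any.Properties using (any⁺)
open import Data.List.Relation.Unary.All as All using (All; []; _∷_)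
open import Data.List.Relation.Unary.All.Properties as All using (all⁻)
open import Data.List.Relation.Unary.Unique.Propositional using (Unique)
open import Data.List.Relation.Unary.Unique.Propositional.Properties as Unique using (upTo⁺)
open import Data.List.Relation.Unary.AllPairs using ([]; _∷_)
open import Data.Product using (∃; ∃₂; _×_; _,_; proj₁; proj₂)
open import Data.Sum using (_⊎_; inj₁; inj₂)
open import Function using (_∘_; _$_)
open import Function.Bundles using (mk⇔; Equivalence)
open import Relation.Unary using (Pred; Decidable)
open import Relation.Nullary using (¬_; yes; no; ¬?; contradiction)
open import Relation.Nullary.Decidable as Dec using (_×-dec_; _⊎-dec_; _→-dec_)
open import Relation.Binary.PropositionalEquality

infix 4 _∋_

_∋_ : NumericalMonoid → ℕ → Set
Γ ∋ x = _∈Γ Γ x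

≤-%-≡⇒+multiple : ∀ {p q m} .{{_ : NonZero m}} → p ≤ q → p % m ≡ q % m → ∃ λ k → q ≡ p + k * m
≤-%-≡⇒+multiple {p} {q} {m} p≤q p%m≡q%m = k , (begin
  q                             ≡⟨ m≡m%n+[m/n]*n q m ⟩
  q % m + q / m * m             ≡⟨ cong₂ _+_ (sym p%m≡q%m) (cong (_* m) (sym (m+[n∸m]≡n (/-monoˡ-≤ m p≤q)))) ⟩
  p % m + (p / m + k) * m       ≡⟨ cong (p % m +_) (*-distribʳ-+ m (p / m) k) ⟩
  p % m + (p / m * m + k * m)   ≡⟨ sym (+-assoc (p % m) _ _) ⟩
  p % m + p / m * m + k * m     ≡⟨ cong (_+ k * m) (sym (m≡m%n+[m/n]*n p m)) ⟩
  p + k * m                     ∎)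
  where
  open ≡-Reasoning
  k : ℕ
  k = q / m ∸ p / m

%-≡⇒+multiple : ∀ {p q m} .{{_ : NonZero m}} → p % m ≡ q % m →
                (∃ λ k → q ≡ p + k * m) ⊎ (∃ λ k → p ≡ q + k * m)
%-≡⇒+multiple {p} {q} p%m≡q%m with ≤-total p q
... | inj₁ p≤q = inj₁ (≤-%-≡⇒+multiple p≤q p%m≡q%m)
... | inj₂ q≤p = inj₂ (≤-%-≡⇒+multiple q≤p (sym p%m≡q%m))

summand<sum : ∀ {a b x} → b ≢ 0 → a + b ≡ x → a < x
summand<sum {a} b≢0 refl = m<m+n a (n≢0⇒n>0 b≢0)

[[a+b]%n+[n∸a%n]]%n≡b%n : ∀ a b n .{{_ : NonZero n}} → ((a + b) % n + (n ∸ a % n)) % n ≡ b % n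
[[a+b]%n+[n∸a%n]]%n≡b%n a b n = begin
  ((a + b) % n + (n ∸ a % n)) % n          ≡⟨ %-distribˡ-+ ((a + b) % n) (n ∸ a % n) n ⟩
  ((a + b) % n % n + (n ∸ a % n) % n) % n  ≡⟨ cong (λ x → (x + (n ∸ a % n) % n) % n) (m%n%n≡m%n (a + b) n) ⟩
  ((a + b) % n + (n ∸ a % n) % n) % n      ≡⟨ sym (%-distribˡ-+ (a + b) (n ∸ a % n) n) ⟩
  (a + b + (n ∸ a % n)) % n                ≡⟨ cong (_% n) regroup ⟩
  (b + suc (a / n) * n) % n                ≡⟨ [m+kn]%n≡m%n b (suc (a / n)) n ⟩
  b % n                                    ∎
  where
  open ≡-Reasoning
  shuffle : ∀ x y b z → x + y + b + z ≡ b + ((x + z) + y)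
  shuffle = solve-∀
  regroup : a + b + (n ∸ a % n) ≡ b + suc (a / n) * n
  regroup = begin
    a + b + (n ∸ a % n)                        ≡⟨ cong (λ x → x + b + (n ∸ a % n)) (m≡m%n+[m/n]*n a n) ⟩
    a % n + a / n * n + b + (n ∸ a % n)        ≡⟨ shuffle (a % n) (a / n * n) b (n ∸ a % n) ⟩
    b + ((a % n + (n ∸ a % n)) + a / n * n)    ≡⟨ cong (λ k → b + (k + a / n * n)) (m+[n∸m]≡n (m%n≤n a n)) ⟩
    b + suc (a / n) * n                        ∎

hasCard-filter-upTo : ∀ {P : Pred ℕ 0ℓ} (P? : Decidable P) b → (∀ {x} → P x → x < b) →
                      HasCard P (length (filter P? (upTo b)))
hasCard-filter-upTo P? b P⇒<b =
  filter P? (upTo b) , Unique.filter⁺ P? (upTo⁺ b) ,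
  (λ x → mk⇔ (proj₂ ∘ ∈-filter⁻ P? {xs = upTo b}) (λ Px → ∈-filter⁺ P? (∈-upTo⁺ (P⇒<b Px)) Px)) , refl

module _ (Γ : NumericalMonoid) where

  Decomposable : ℕ → Set
  Decomposable x = ∃₂ λ a b → Γ ∋ a × Γ ∋ b × a ≢ 0 × b ≢ 0 × a + b ≡ x

  decomposable? : Decidable Decomposable
  decomposable? x = Dec.map′ decomposition witness (anyUpTo? summand? x)
    where
    summand? : Decidable λ a → Γ ∋ a × Γ ∋ x ∸ a × a ≢ 0 × x ∸ a ≢ 0
    summand? a = dec Γ a ×-dec dec Γ (x ∸ a) ×-dec ¬? (a ≟ 0) ×-dec ¬? (x ∸ a ≟ 0)

    decomposition : (∃ λ a → a < x × Γ ∋ a × Γ ∋ x ∸ a × a ≢ 0 × x ∸ a ≢ 0) → Decomposable x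
    decomposition (a , a<x , a∈Γ , b∈Γ , a≢0 , b≢0) = a , x ∸ a , a∈Γ , b∈Γ , a≢0 , b≢0 , m+[n∸m]≡n (<⇒≤ a<x)

    witness : Decomposable x → ∃ λ a → a < x × Γ ∋ a × Γ ∋ x ∸ a × a ≢ 0 × x ∸ a ≢ 0
    witness (a , b , a∈Γ , b∈Γ , a≢0 , b≢0 , a+b≡x) =
      a , summand<sum b≢0 a+b≡x , a∈Γ , subst (Γ ∋_) b≡x∸a b∈Γ , a≢0 , b≢0 ∘ trans b≡x∸a
      where
      b≡x∸a : b ≡ x ∸ a
      b≡x∸a = trans (sym (m+n∸m≡n a b)) (cong (_∸ a) a+b≡x)

  minGen? : Decidable (MinGen Γ)
  minGen? x = dec Γ x ×-dec ¬? (x ≟ 0) ×-dec ¬? (decomposable? x)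

  minGen-summand : ∀ {x} → Γ ∋ x → x ≢ 0 → ∃₂ λ g c → MinGen Γ g × Γ ∋ c × g + c ≡ x
  minGen-summand = go (<-wellFounded _)
    where
    go : ∀ {x} → Acc _<_ x → Γ ∋ x → x ≢ 0 → ∃₂ λ g c → MinGen Γ g × Γ ∋ c × g + c ≡ x
    go {x} (acc smaller) x∈Γ x≢0 with decomposable? x
    ... | no indecomposable = x , 0 , (x∈Γ , x≢0 , indecomposable) , zero∈ Γ , +-identityʳ x
    ... | yes (a , b , a∈Γ , b∈Γ , a≢0 , b≢0 , a+b≡x)
        with go (smaller (summand<sum b≢0 a+b≡x)) a∈Γ a≢0
    ...   | g , c , g-gen , c∈Γ , g+c≡a =
      g , c + b , g-gen , closed Γ c∈Γ b∈Γ , trans (sym (+-assoc g c b)) (trans (cong (_+ b) g+c≡a) a+b≡x)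

  pf? : Decidable (PF Γ)
  pf? p = ¬? (dec Γ p) ×-dec Dec.map′ extend restrict (allUpTo? shifts? (suc F))
    where
    F : ℕ
    F = proj₁ (cofinite Γ)

    shifts? : Decidable λ g → Γ ∋ g → g ≢ 0 → Γ ∋ p + g
    shifts? g = dec Γ g →-dec ¬? (g ≟ 0) →-dec dec Γ (p + g)

    extend : (∀ {g} → g < suc F → Γ ∋ g → g ≢ 0 → Γ ∋ p + g) → ∀ g → Γ ∋ g → g ≢ 0 → Γ ∋ p + g
    extend small g with g ≤? F
    ... | yes g≤F = small (s≤s g≤F)
    ... | no g≰F = λ _ _ → proj₂ (cofinite Γ) (p + g) (<-≤-trans (≰⇒> g≰F) (m≤n+m g p))

    restrict : (∀ g → Γ ∋ g → g ≢ 0 → Γ ∋ p + g) → ∀ {g} → g < suc F → Γ ∋ g → g ≢ 0 → Γ ∋ p + g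
    restrict shifts {g} _ = shifts g

  pf-bounded : ∀ {F p} → (∀ n → F < n → Γ ∋ n) → PF Γ p → p ≤ F
  pf-bounded above (p∉Γ , _) = ≮⇒≥ (λ F<p → p∉Γ (above _ F<p))

  minGen-bounded : ∀ {F m g} → Mult Γ m → (∀ n → F < n → Γ ∋ n) → MinGen Γ g → g ≤ F + m
  minGen-bounded {F} {m} {g} (m∈Γ , m≢0 , _) above (_ , _ , indecomposable) = ≮⇒≥ λ F+m<g →
    let F<g∸m = subst (_< g ∸ m) (m+n∸n≡m F m) (∸-monoˡ-< F+m<g (m≤n+m m F)) in
    indecomposable (m , g ∸ m , m∈Γ , above _ F<g∸m , m≢0 , m<n⇒n≢0 F<g∸m ,
                    m+[n∸m]≡n (≤-trans (m≤n+m m F) (<⇒≤ F+m<g)))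

module _ {A : Set} {n : ℕ} where

  image : (A → Fin n) → List A → Subset n
  image f []       = ⊥
  image f (x ∷ xs) = ⁅ f x ⁆ ∪ image f xs

  ∈-image⁺ : ∀ f {x xs} → x ∈ xs → f x ∈ₛ image f xs
  ∈-image⁺ f (here refl)               = x∈p∪q⁺ (inj₁ (x∈⁅x⁆ (f _)))
  ∈-image⁺ f {xs = y ∷ _} (there x∈xs) = x∈p∪q⁺ {p = ⁅ f y ⁆} (inj₂ (∈-image⁺ f x∈xs))

  ∈-image⁻ : ∀ f {i} xs → i ∈ₛ image f xs → ∃ λ x → x ∈ xs × f x ≡ i
  ∈-image⁻ f []       i∈⊥ = contradiction i∈⊥ ∉⊥
  ∈-image⁻ f (x ∷ xs) i∈image with x∈p∪q⁻ ⁅ f x ⁆ (image f xs) i∈image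
  ... | inj₁ i∈⁅fx⁆ = x , here refl , sym (x∈⁅y⁆⇒x≡y (f x) i∈⁅fx⁆)
  ... | inj₂ i∈rest = let (y , y∈xs , fy≡i) = ∈-image⁻ f xs i∈rest in y , there y∈xs , fy≡i

∣⁅x⁆∪p∣≤1+∣p∣ : ∀ {n} (x : Fin n) (p : Subset n) → ∣ ⁅ x ⁆ ∪ p ∣ ≤ suc ∣ p ∣
∣⁅x⁆∪p∣≤1+∣p∣ 0F          (s ∷ p) rewrite ∪-identityˡ p = s≤s (∣p∣≤∣x∷p∣ s p)
∣⁅x⁆∪p∣≤1+∣p∣ (Fin.suc x) (inside ∷ p)  = s≤s (∣⁅x⁆∪p∣≤1+∣p∣ x p)
∣⁅x⁆∪p∣≤1+∣p∣ (Fin.suc x) (outside ∷ p) = ∣⁅x⁆∪p∣≤1+∣p∣ x p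

∣image∣≤length : ∀ {A : Set} {n} (f : A → Fin n) xs → ∣ image f xs ∣ ≤ length xs
∣image∣≤length {n = n} f [] = ≤-reflexive (∣⊥∣≡0 n)
∣image∣≤length f (x ∷ xs) = ≤-trans (∣⁅x⁆∪p∣≤1+∣p∣ (f x) (image f xs)) (s≤s (∣image∣≤length f xs))

unique⇒length≤∣p∣ : ∀ {n} {p : Subset n} {xs} → Unique xs → All (_∈ₛ p) xs → length xs ≤ ∣ p ∣
unique⇒length≤∣p∣ [] [] = z≤n
unique⇒length≤∣p∣ {p = p} {x ∷ xs} (x∉xs ∷ xs-unique) (x∈p ∷ xs⊆p) = begin
  suc (length xs) ≤⟨ s≤s (unique⇒length≤∣p∣ xs-unique (All.zipWith in-p-x (xs⊆p , x∉xs))) ⟩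
  suc ∣ p - x ∣   ≤⟨ x∈p⇒∣p-x∣<∣p∣ x∈p ⟩
  ∣ p ∣           ∎
  where
  open ≤-Reasoning
  in-p-x : ∀ {y} → y ∈ₛ p × x ≢ y → y ∈ₛ p - x
  in-p-x (y∈p , x≢y) = x∈p∧x≢y⇒x∈p-y y∈p (≢-sym x≢y)

unique-map-injectiveOn : ∀ {A B : Set} {Q : Pred A 0ℓ} {f : A → B} {xs} →
                         (∀ {x y} → Q x → Q y → f x ≡ f y → x ≡ y) → All Q xs → Unique xs →
                         Unique (map f xs)
unique-map-injectiveOn injective [] [] = []
unique-map-injectiveOn injective (qx ∷ qxs) (x∉xs ∷ xs-unique) =
  All.map⁺ (All.zipWith (λ (qy , x≢y) → x≢y ∘ injective qx qy) (qxs , x∉xs)) ∷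
  unique-map-injectiveOn injective qxs xs-unique

subsetsOfSize≤ : ∀ n → ℕ → List (Subset n)
subsetsOfSize≤ zero    _       = [] ∷ []
subsetsOfSize≤ (suc n) zero    = map (outside ∷_) (subsetsOfSize≤ n zero)
subsetsOfSize≤ (suc n) (suc k) =
  map (inside ∷_) (subsetsOfSize≤ n k) ++ map (outside ∷_) (subsetsOfSize≤ n (suc k))

∈-subsetsOfSize≤ : ∀ {n k} (p : Subset n) → ∣ p ∣ ≤ k → p ∈ subsetsOfSize≤ n k
∈-subsetsOfSize≤              []            _            = here refl
∈-subsetsOfSize≤ {k = zero}   (outside ∷ p) ∣p∣≤0        = ∈-map⁺ (outside ∷_) (∈-subsetsOfSize≤ p ∣p∣≤0)
∈-subsetsOfSize≤ {k = zero}   (inside ∷ p)  ()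
∈-subsetsOfSize≤ {k = suc k}  (inside ∷ p)  (s≤s ∣p∣≤k)  =
  ∈-++⁺ˡ (∈-map⁺ (inside ∷_) (∈-subsetsOfSize≤ p ∣p∣≤k))
∈-subsetsOfSize≤ {k = suc k}  (outside ∷ p) ∣p∣≤1+k      =
  ∈-++⁺ʳ (map (inside ∷_) (subsetsOfSize≤ _ k)) (∈-map⁺ (outside ∷_) (∈-subsetsOfSize≤ p ∣p∣≤1+k))

T-any : ∀ {A : Set} (f : A → Bool) xs {x} → x ∈ xs → T (f x) → T (any f xs)
T-any f xs x∈xs fx = any⁺ f (lose x∈xs fx)

any≡false⇒¬T : ∀ {A : Set} (f : A → Bool) xs {x} → any f xs ≡ false → x ∈ xs → ¬ T (f x)
any≡false⇒¬T f xs any≡false x∈xs fx = subst T any≡false (T-any f xs x∈xs fx)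

∈ₛ⇒T-lookup : ∀ {n} {x : Fin n} {p : Subset n} → x ∈ₛ p → T (lookup p x)
∈ₛ⇒T-lookup x∈p = Equivalence.from T-≡ ([]=⇒lookup x∈p)

module _ {n : ℕ} .{{_ : NonZero n}} where

  _⊖_ : Fin n → Fin n → Fin n
  r ⊖ a = (toℕ r + (n ∸ toℕ a)) mod n

  Covered : Subset n → Subset n → Fin n → Set
  Covered N H r = r ∈ₛ H ⊎ ∃ λ a → a ∈ₛ H × a ∈ₛ N × r ⊖ a ∈ₛ N

  Covers : Subset n → Subset n → Set
  Covers N H = ∀ r → toℕ r ≢ 0 → Covered N H r

  coveredᵇ : Subset n → Subset n → Fin n → Bool
  coveredᵇ N H r = lookup H r ∨ any (λ a → lookup H a ∧ lookup N a ∧ lookup N (r ⊖ a)) (allFin n)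

  coversᵇ : Subset n → Subset n → Bool
  coversᵇ N H = all (λ r → (toℕ r ≡ᵇ 0) ∨ coveredᵇ N H r) (allFin n)

  covered⇒coveredᵇ : ∀ {N H r} → Covered N H r → T (coveredᵇ N H r)
  covered⇒coveredᵇ (inj₁ r∈H) = Equivalence.from T-∨ (inj₁ (∈ₛ⇒T-lookup r∈H))
  covered⇒coveredᵇ (inj₂ (a , a∈H , a∈N , r⊖a∈N)) =
    Equivalence.from T-∨ (inj₂ (T-any _ (allFin n) (∈-allFin a) (Equivalence.from T-∧
      (∈ₛ⇒T-lookup a∈H , Equivalence.from T-∧ (∈ₛ⇒T-lookup a∈N , ∈ₛ⇒T-lookup r⊖a∈N)))))

  covers⇒coversᵇ : ∀ {N H} → Covers N H → T (coversᵇ N H)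
  covers⇒coversᵇ {N} {H} cover =
    all⁻ _ {allFin n} (All.tabulate λ {r} _ → Equivalence.from T-∨ (zero-or-covered r))
    where
    zero-or-covered : ∀ r → T (toℕ r ≡ᵇ 0) ⊎ T (coveredᵇ N H r)
    zero-or-covered r with toℕ r ≟ 0
    ... | yes r≡0 = inj₁ (≡⇒≡ᵇ _ 0 r≡0)
    ... | no  r≢0 = inj₂ (covered⇒coveredᵇ (cover r r≢0))

no-small-cover-mod-11 : ∀ (N H : Subset 11) → 0F ∈ₛ N → ∣ N ∣ ≤ 4 → ∣ H ∣ ≤ 4 → ¬ Covers N H
no-small-cover-mod-11 (inside ∷ N) H here (s≤s ∣N∣≤3) ∣H∣≤4 cover =
  any≡false⇒¬T coverable (subsetsOfSize≤ 10 3) search (∈-subsetsOfSize≤ N ∣N∣≤3)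
    (T-any (coversᵇ (inside ∷ N)) (subsetsOfSize≤ 11 4) (∈-subsetsOfSize≤ H ∣H∣≤4) (covers⇒coversᵇ cover))
  where
  coverable : Subset 10 → Bool
  coverable N = any (coversᵇ (inside ∷ N)) (subsetsOfSize≤ 11 4)

  -- An exhaustive search through 176 candidates for N and 562 for H.
  search : any coverable (subsetsOfSize≤ 10 3) ≡ false
  search = refl

module Residues (Γ : NumericalMonoid) {m : ℕ} (mult : Mult Γ m) where

  private
    m∈Γ : Γ ∋ m
    m∈Γ = proj₁ mult
    m≢0 : m ≢ 0
    m≢0 = proj₁ (proj₂ mult)
    instance
      m-nonZero : NonZero m
      m-nonZero = ≢-nonZero m≢0

  multiple∈Γ : ∀ k → Γ ∋ k * m
  multiple∈Γ zero    = zero∈ Γ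
  multiple∈Γ (suc k) = closed Γ m∈Γ (multiple∈Γ k)

  mult-minGen : MinGen Γ m
  mult-minGen = m∈Γ , m≢0 , λ (a , b , a∈Γ , b∈Γ , a≢0 , b≢0 , a+b≡m) →
    <⇒≱ (summand<sum b≢0 a+b≡m) (proj₂ (proj₂ mult) a a∈Γ a≢0)

  pf+multiple∈Γ : ∀ {p} k → PF Γ p → Γ ∋ p + suc k * m
  pf+multiple∈Γ k (_ , shift) = shift (suc k * m) (multiple∈Γ (suc k)) (m<n⇒n≢0 (m≤m*n (suc k) m))

  pf-residue≢0 : ∀ {p} → PF Γ p → p % m ≢ 0
  pf-residue≢0 {p} (p∉Γ , _) p%m≡0 with ≤-%-≡⇒+multiple {0} {p} z≤n (trans (m*n%n≡0 0 m) (sym p%m≡0))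
  ... | k , refl = p∉Γ (multiple∈Γ k)

  pf-residue-injective : ∀ {p q} → PF Γ p → PF Γ q → p % m ≡ q % m → p ≡ q
  pf-residue-injective {p} {q} p-pf q-pf p%m≡q%m with %-≡⇒+multiple {p} {q} {m} p%m≡q%m
  ... | inj₁ (zero  , refl) = sym (+-identityʳ p)
  ... | inj₁ (suc k , refl) = contradiction (pf+multiple∈Γ k p-pf) (proj₁ q-pf)
  ... | inj₂ (zero  , refl) = +-identityʳ _
  ... | inj₂ (suc k , refl) = contradiction (pf+multiple∈Γ k q-pf) (proj₁ p-pf)

  congruent-element-above-pf : ∀ {p q} → PF Γ p → Γ ∋ q → p % m ≡ q % m → ∃ λ k → q ≡ p + suc k * m
  congruent-element-above-pf {p} {q} (p∉Γ , _) q∈Γ p%m≡q%m with %-≡⇒+multiple {p} {q} {m} p%m≡q%m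
  ... | inj₁ (zero  , refl) = contradiction (subst (Γ ∋_) (+-identityʳ p) q∈Γ) p∉Γ
  ... | inj₁ (suc k , q≡p+[1+k]m) = k , q≡p+[1+k]m
  ... | inj₂ (k , refl) = contradiction (closed Γ q∈Γ (multiple∈Γ k)) p∉Γ

  Apéry : ℕ → Set
  Apéry w = Γ ∋ w × ∀ {y} → Γ ∋ y → y + m ≢ w

  apéry-exists : ∀ r → r < m → ∃ λ w → Apéry w × w % m ≡ r
  apéry-exists r r<m =
    let (j , w-apéry) = descend (suc F) (above _ F<r+[1+F]m)
    in r + j * m , w-apéry , trans ([m+kn]%n≡m%n r j m) (m<n⇒m%n≡m r<m)
    where
    F : ℕ
    F = proj₁ (cofinite Γ)
    above : ∀ n → F < n → Γ ∋ n
    above = proj₂ (cofinite Γ)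
    F<r+[1+F]m : F < r + suc F * m
    F<r+[1+F]m = ≤-trans (m≤m*n (suc F) m) (m≤n+m _ r)

    descend : ∀ k → Γ ∋ r + k * m → ∃ λ j → Apéry (r + j * m)
    descend zero r∈Γ = 0 , r∈Γ , λ {y} _ y+m≡r →
      <⇒≱ r<m (subst (m ≤_) (trans y+m≡r (+-identityʳ r)) (m≤n+m m y))
    descend (suc k) r+[1+k]m∈Γ with dec Γ (r + k * m)
    ... | yes r+km∈Γ = descend k r+km∈Γ
    ... | no  r+km∉Γ = suc k , r+[1+k]m∈Γ , λ {y} y∈Γ y+m≡w →
      r+km∉Γ (subst (Γ ∋_) (+-cancelʳ-≡ m y (r + k * m) (trans y+m≡w step)) y∈Γ)
      where
      step : r + suc k * m ≡ r + k * m + m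
      step = trans (cong (r +_) (+-comm m (k * m))) (sym (+-assoc r (k * m) m))

  apéry-summand-not-pf-residue : ∀ {w q x p} → Apéry w → Γ ∋ q → Γ ∋ x → x ≢ 0 → q + x ≡ w →
                                 PF Γ p → p % m ≢ q % m
  apéry-summand-not-pf-residue {w} {q} {x} {p} (_ , w∸m∉Γ) q∈Γ x∈Γ x≢0 q+x≡w p-pf p%m≡q%m
    with congruent-element-above-pf p-pf q∈Γ p%m≡q%m
  ... | k , refl = w∸m∉Γ (closed Γ (proj₂ p-pf x x∈Γ x≢0) (multiple∈Γ k)) (trans (regroup p x k m) q+x≡w)
    where regroup : ∀ p x k m → p + x + k * m + m ≡ p + suc k * m + x
          regroup = solve-∀

  residue : ℕ → Fin m
  residue x = x mod m

  toℕ-residue : ∀ x → toℕ (residue x) ≡ x % m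
  toℕ-residue x = toℕ-fromℕ< _

  residue-%-≡ : ∀ {x y} → residue x ≡ residue y → x % m ≡ y % m
  residue-%-≡ {x} {y} eq = trans (sym (toℕ-residue x)) (trans (cong toℕ eq) (toℕ-residue y))

  nonPFResidues : List ℕ → Subset m
  nonPFResidues P = ∁ (image residue P)

  ≢m? : Decidable (_≢ m)
  ≢m? g = ¬? (g ≟ m)

  generatorResidues : List ℕ → Subset m
  generatorResidues L = image residue (filter ≢m? L)

  ∈-nonPFResidues : ∀ {P x} → All (PF Γ) P → (∀ {p} → PF Γ p → p % m ≢ x % m) →
                    residue x ∈ₛ nonPFResidues P
  ∈-nonPFResidues {P} P-pf no-pf = x∉p⇒x∈∁p λ x∈image →
    let (p , p∈P , same-residue) = ∈-image⁻ residue P x∈image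
    in no-pf (All.lookup P-pf p∈P) (residue-%-≡ same-residue)

  0∈nonPFResidues : ∀ {P} → All (PF Γ) P → residue 0 ∈ₛ nonPFResidues P
  0∈nonPFResidues P-pf = ∈-nonPFResidues P-pf λ p-pf p%m≡0%m →
    pf-residue≢0 p-pf (trans p%m≡0%m (m*n%n≡0 0 m))

  ∣nonPFResidues∣≤m∸length : ∀ {P} → Unique P → All (PF Γ) P → ∣ nonPFResidues P ∣ ≤ m ∸ length P
  ∣nonPFResidues∣≤m∸length {P} P-unique P-pf = begin
    ∣ ∁ (image residue P) ∣ ≡⟨ ∣∁p∣≡n∸∣p∣ (image residue P) ⟩
    m ∸ ∣ image residue P ∣ ≤⟨ ∸-monoʳ-≤ m length≤∣image∣ ⟩
    m ∸ length P            ∎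
    where
    open ≤-Reasoning
    length≤∣image∣ : length P ≤ ∣ image residue P ∣
    length≤∣image∣ = subst (_≤ ∣ image residue P ∣) (length-map residue P) $ unique⇒length≤∣p∣
      (unique-map-injectiveOn (λ p-pf q-pf → pf-residue-injective p-pf q-pf ∘ residue-%-≡) P-pf P-unique)
      (All.map⁺ (All.tabulate (∈-image⁺ residue)))

  ∣generatorResidues∣<length : ∀ {L} → m ∈ L → ∣ generatorResidues L ∣ < length L
  ∣generatorResidues∣<length {L} m∈L = ≤-<-trans (∣image∣≤length residue (filter ≢m? L))
    (filter-notAll ≢m? L (Any.map (λ m≡g g≢m → g≢m (sym m≡g)) m∈L))

  residue-⊖ : ∀ {g s w} → g + s ≡ w → residue s ≡ residue w ⊖ residue g
  residue-⊖ {g} {s} {w} g+s≡w = toℕ-injective (begin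
    toℕ (residue s)                               ≡⟨ toℕ-residue s ⟩
    s % m                                         ≡⟨ sym ([[a+b]%n+[n∸a%n]]%n≡b%n g s m) ⟩
    ((g + s) % m + (m ∸ g % m)) % m               ≡⟨ cong₂ (λ a b → (a + (m ∸ b)) % m)
                                                       (trans (cong (_% m) g+s≡w) (sym (toℕ-residue w)))
                                                       (sym (toℕ-residue g)) ⟩
    (toℕ (residue w) + (m ∸ toℕ (residue g))) % m ≡⟨ sym (toℕ-residue _) ⟩
    toℕ (residue w ⊖ residue g)                   ∎)
    where open ≡-Reasoning

  apéry-covered : ∀ {L P w} → (∀ {g} → MinGen Γ g → g ∈ L) → All (PF Γ) P → Apéry w → w % m ≢ 0 →
                  Covered (nonPFResidues P) (generatorResidues L) (residue w)
  apéry-covered {L} {P} {w} gens P-pf w-apéry@(w∈Γ , w∸m∉Γ) w%m≢0 with decomposable? Γ w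
  ... | no indecomposable = inj₁ (∈-image⁺ residue (∈-filter⁺ ≢m? (gens (w∈Γ , w≢0 , indecomposable)) w≢m))
    where
    w≢0 : w ≢ 0
    w≢0 refl = w%m≢0 (m*n%n≡0 0 m)
    w≢m : w ≢ m
    w≢m refl = w%m≢0 (n%n≡0 m)
  ... | yes (q , x , q∈Γ , x∈Γ , q≢0 , x≢0 , q+x≡w) with minGen-summand Γ q∈Γ q≢0
  ... | g , c , g-gen@(g∈Γ , g≢0 , _) , c∈Γ , g+c≡q =
    inj₂ (residue g , g∈H , g∈N , subst (_∈ₛ nonPFResidues P) (residue-⊖ g+s≡w) s∈N)
    where
    s : ℕ
    s = c + x
    s∈Γ : Γ ∋ s
    s∈Γ = closed Γ c∈Γ x∈Γ
    s≢0 : s ≢ 0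
    s≢0 = x≢0 ∘ m+n≡0⇒n≡0 c
    g+s≡w : g + s ≡ w
    g+s≡w = trans (sym (+-assoc g c x)) (trans (cong (_+ x) g+c≡q) q+x≡w)
    g≢m : g ≢ m
    g≢m refl = w∸m∉Γ s∈Γ (trans (+-comm s m) g+s≡w)
    g∈H : residue g ∈ₛ generatorResidues L
    g∈H = ∈-image⁺ residue (∈-filter⁺ ≢m? (gens g-gen) g≢m)
    g∈N : residue g ∈ₛ nonPFResidues P
    g∈N = ∈-nonPFResidues P-pf (apéry-summand-not-pf-residue w-apéry g∈Γ s∈Γ s≢0 g+s≡w)
    s∈N : residue s ∈ₛ nonPFResidues P
    s∈N = ∈-nonPFResidues P-pf (apéry-summand-not-pf-residue w-apéry s∈Γ g∈Γ g≢0 (trans (+-comm s g) g+s≡w))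

  residues-covered : ∀ {L P} → (∀ {g} → MinGen Γ g → g ∈ L) → All (PF Γ) P →
                     Covers (nonPFResidues P) (generatorResidues L)
  residues-covered gens P-pf r r≢0 =
    let (w , w-apéry , w%m≡r) = apéry-exists (toℕ r) (toℕ<n r)
    in subst (Covered _ _) (toℕ-injective (trans (toℕ-residue w) w%m≡r))
             (apéry-covered gens P-pf w-apéry (r≢0 ∘ trans (sym w%m≡r)))

type≤6 : ∀ {Γ t} → Edim Γ 5 → Mult Γ 11 → Type Γ t → t ≤ 6
type≤6 {Γ} {t} (L , _ , L↔gens , ∣L∣≡5) mult (P , P-unique , P↔pf , ∣P∣≡t) with t ≤? 6
... | yes t≤6 = t≤6
... | no  t≰6 =
  contradiction (residues-covered gens P-pf) (no-small-cover-mod-11 N H (0∈nonPFResidues P-pf) ∣N∣≤4 ∣H∣≤4)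
  where
  open Residues Γ mult
  gens : ∀ {g} → MinGen Γ g → g ∈ L
  gens = Equivalence.from (L↔gens _)
  P-pf : All (PF Γ) P
  P-pf = All.tabulate (Equivalence.to (P↔pf _))
  N H : Subset 11
  N = nonPFResidues P
  H = generatorResidues L
  ∣N∣≤4 : ∣ N ∣ ≤ 4
  ∣N∣≤4 = ≤-trans (∣nonPFResidues∣≤m∸length P-unique P-pf)
                  (∸-monoʳ-≤ 11 (subst (7 ≤_) (sym ∣P∣≡t) (≰⇒> t≰6)))
  ∣H∣≤4 : ∣ H ∣ ≤ 4
  ∣H∣≤4 = ≤-pred (subst (∣ H ∣ <_) ∣L∣≡5 (∣generatorResidues∣<length (gens mult-minGen)))

-- Γ₀ = ⟨11, 12, 13, 14, 18⟩, with pseudo-Frobenius numbers 15, 16, 17, 19, 20, 21.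
Γ₀-elem : ℕ → Set
Γ₀-elem x = x ≡ 0 ⊎ (11 ≤ x × x ≤ 14) ⊎ x ≡ 18 ⊎ 22 ≤ x

Γ₀-elem-≥11 : ∀ {x} → Γ₀-elem x → x ≢ 0 → 11 ≤ x
Γ₀-elem-≥11 (inj₁ x≡0)                   x≢0 = contradiction x≡0 x≢0
Γ₀-elem-≥11 (inj₂ (inj₁ (11≤x , _)))      _   = 11≤x
Γ₀-elem-≥11 (inj₂ (inj₂ (inj₁ refl)))     _   = m≤m+n 11 7
Γ₀-elem-≥11 (inj₂ (inj₂ (inj₂ 22≤x)))     _   = ≤-trans (m≤m+n 11 11) 22≤x

Γ₀-elem-+ : ∀ {a b} → Γ₀-elem a → Γ₀-elem b → Γ₀-elem (a + b)
Γ₀-elem-+ {a} {b} a∈ b∈ with a ≟ 0 | b ≟ 0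
... | yes refl | _        = b∈
... | no _     | yes refl = subst Γ₀-elem (sym (+-identityʳ a)) a∈
... | no a≢0   | no b≢0   = inj₂ (inj₂ (inj₂ (+-mono-≤ (Γ₀-elem-≥11 a∈ a≢0) (Γ₀-elem-≥11 b∈ b≢0))))

Γ₀ : NumericalMonoid
Γ₀ = record
  { _∈Γ      = Γ₀-elem
  ; dec      = λ x → x ≟ 0 ⊎-dec (11 ≤? x ×-dec x ≤? 14) ⊎-dec x ≟ 18 ⊎-dec 22 ≤? x
  ; zero∈    = inj₁ refl
  ; closed   = Γ₀-elem-+
  ; cofinite = 21 , λ _ → inj₂ ∘ inj₂ ∘ inj₂
  }

mult₀ : Mult Γ₀ 11
mult₀ = inj₂ (inj₁ (≤-refl , m≤m+n 11 3)) , (λ ()) , λ _ → Γ₀-elem-≥11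

edim₀ : Edim Γ₀ 5
edim₀ = hasCard-filter-upTo (minGen? Γ₀) 33 λ gen → s≤s (minGen-bounded Γ₀ mult₀ (proj₂ (cofinite Γ₀)) gen)

type₀ : Type Γ₀ 6
type₀ = hasCard-filter-upTo (pf? Γ₀) 22 λ pf → s≤s (pf-bounded Γ₀ (proj₂ (cofinite Γ₀)) pf)

𝒟[4,11]≡7 : 𝒟 4 11 ≡ 7
𝒟[4,11]≡7 = refl

proposition5p4 : IsT 4 11 (𝒟 4 11 ∸ 1)
proposition5p4 rewrite 𝒟[4,11]≡7 = (Γ₀ , edim₀ , mult₀ , type₀) , λ Γ t → type≤6 {Γ} {t}
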